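{- Let $n\ge 1$ and let $\mathcal{H}$ be an $n$-uniform linear hypergraph with exactly $n$ hyperedges $F_1,\dots,F_n$. Then the identifier spanning trees can be chosen so that the resulting auxiliary graph of the second kind $G_2(\mathcal{H})$ admits a Vandermonde-completable orientation of its identifier edges.
   Context: A hypergraph is linear if any two distinct edges share at most one vertex; for $v\in V(\mathcal{H})$, $d(v)$ is the number of edges containing $v$. The auxiliary graph of the second kind $G_2(\mathcal{H})$ is the graph built as follows. For each $i=1,\dots,n$ take a copy $K_n^{(i)}$ of the complete graph $K_n$ (the $i$-th base clique) with vertices $v_{i,1},\dots,v_{i,n}$, labelled bijectively by the $n$ vertices of $F_i$; the base cliques are vertex-disjoint, so each $v\in V(\mathcal{H})$ labels exactly $d(v)$ vertices. For each $v\in V(\mathcal{H})$ choose a spanning tree (identifier spanning tree) on the set of the $d(v)$ vertices labelled by $v$. For each edge $v_{i,j}v_{k,l}$ of an identifier spanning tree with $i<k$, the edges $v_{i,j}v_{k,t}$ for all $t\ne l$ (each with multiplicity one) are added to $G_2(\mathcal{H})$; these are the identifier edges. The edge set of $G_2(\mathcal{H})$ consists of the edges of the base cliques together with the identifier edges. An orientation of the identifier edges is called Vandermonde-completable if the edges of the base cliques can be oriented so that each base clique becomes a transitive tournament and every vertex of the whole graph $G_2(\mathcal{H})$ has in-degree at most $n-1$. -}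

module Defs where

open import Data.Nat using (ℕ; zero; suc; _+_; _∸_; _≤_; _<_)
open import Data.Bool using (Bool; true; false; if_then_else_; _∧_; _∨_; not)
open import Data.Fin using (Fin; zero; suc; toℕ; inject₁; fromℕ) renaming (_≟_ to _≟ᶠ_)
open import Data.Product using (Σ; _×_; _,_; proj₁; proj₂; ∃)
import Data.Product.Properties as ×P
open import Data.List using (List; []; _∷_; length; lookup; concatMap; filter; allFin; map)
open import Data.List.Membership.Propositional using (_∈_)
open import Data.List.Relation.Unary.Unique.Propositional using (Unique)
open import Data.Sum using (_⊎_)
open import Relation.Nullary using (¬_; ¬?)
open import Relation.Nullary.Decidable using (⌊_⌋)
open import Relation.Binary.PropositionalEquality using (_≡_; _≢_)
open import Relation.Binary.Construct.Closure.ReflexiveTransitive using (Star)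
open import Function.Definitions using (Injective)

count : ∀ {n} → (Fin n → Bool) → ℕ
count {zero}  f = 0
count {suc n} f = (if f zero then 1 else 0) + count (λ k → f (suc k))

_==_ : ∀ {n} → Fin n → Fin n → Bool
a == b = ⌊ a ≟ᶠ b ⌋

-- Vertices of G₂(H): v_{i,j} is represented by the pair (i , j):
-- i = index of the base clique (hyperedge F_i), j = position in the clique.
Pt : ℕ → Set
Pt n = Fin n × Fin n

_==ᵖ_ : ∀ {n} → Pt n → Pt n → Bool
p ==ᵖ q = ⌊ ×P.≡-dec _≟ᶠ_ _≟ᶠ_ p q ⌋

-- A hypergraph H with vertex set Fin m and n hyperedges F_0..F_{n-1}, each of
-- size n, is given by a labelling  lab : Fin n → Fin n → Fin m  where
-- lab i : Fin n → Fin m is a bijection of the i-th base clique onto F_i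
-- (so F_i = image of lab i, and lab i is injective = n-uniformity).
Uniform : ∀ {n m} → (Fin n → Fin n → Fin m) → Set
Uniform lab = ∀ i → Injective _≡_ _≡_ (lab i)

Linear : ∀ {n m} → (Fin n → Fin n → Fin m) → Set
Linear {n} lab = ∀ (i k : Fin n) → i ≢ k → ∀ (j j' l l' : Fin n) →
  lab i j ≡ lab k l → lab i j' ≡ lab k l' → j ≡ j'

LabelledBy : ∀ {n m} → (Fin n → Fin n → Fin m) → Fin m → Pt n → Set
LabelledBy lab v (i , j) = lab i j ≡ v

-- An edge list; each (unordered) edge {a , b} is stored as the ordered pair
-- (a , b) with row a < row b (all vertices with a common label lie in
-- distinct base cliques, so this is no restriction).
Adj : ∀ {n} → List (Pt n × Pt n) → Pt n → Pt n → Set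
Adj E a b = ((a , b) ∈ E) ⊎ ((b , a) ∈ E)

Cycle : ∀ {n} → List (Pt n × Pt n) → Set
Cycle {n} E = Σ ℕ λ k → Σ (Fin (suc (suc (suc k))) → Pt n) λ xs →
  Injective _≡_ _≡_ xs ×
  (∀ (i : Fin (suc (suc k))) → Adj E (xs (inject₁ i)) (xs (suc i))) ×
  Adj E (xs (fromℕ (suc (suc k)))) (xs zero)

IsIdentifierSpanningTree : ∀ {n m} → (Fin n → Fin n → Fin m) → Fin m →
  List (Pt n × Pt n) → Set
IsIdentifierSpanningTree {n} lab v E =
  (∀ {a b} → (a , b) ∈ E →
     LabelledBy lab v a × LabelledBy lab v b × toℕ (proj₁ a) < toℕ (proj₁ b)) ×
  Unique E ×
  (∀ a b → LabelledBy lab v a → LabelledBy lab v b → Star (Adj E) a b) ×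
  ¬ Cycle E

idEdgesOf : ∀ {n} → Pt n × Pt n → List (Pt n × Pt n)
idEdgesOf {n} ((i , j) , (k , l)) =
  map (λ t → ((i , j) , (k , t))) (filter (λ t → ¬? (t ≟ᶠ l)) (allFin n))

-- All identifier edges of G₂(H) for the choice T of identifier spanning trees
-- (a list: each identifier edge is added with multiplicity one per tree edge).
idEdges : ∀ {n m} → (Fin m → List (Pt n × Pt n)) → List (Pt n × Pt n)
idEdges {m = m} T = concatMap (λ v → concatMap idEdgesOf (T v)) (allFin m)

-- An orientation of the identifier edges: o e = true means the e-th identifier
-- edge (a , b) is oriented a → b, false means b → a.
IdOrientation : ∀ {n m} → (Fin m → List (Pt n × Pt n)) → Set
IdOrientation T = Fin (length (idEdges T)) → Bool

-- Orientation of the base clique edges: D i j j' = true means v_{i,j} → v_{i,j'}.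
-- Each base clique becomes a tournament that is transitive.
IsTransitiveTournament : ∀ {n} → (Fin n → Fin n → Bool) → Set
IsTransitiveTournament {n} D =
  (∀ j j' → j ≢ j' → (D j j' ≡ true × D j' j ≡ false) ⊎ (D j j' ≡ false × D j' j ≡ true)) ×
  (∀ j → D j j ≡ false) ×
  (∀ j j' j'' → D j j' ≡ true → D j' j'' ≡ true → D j j'' ≡ true)

inDegree : ∀ {n m} (T : Fin m → List (Pt n × Pt n)) → IdOrientation T →
  (Fin n → Fin n → Fin n → Bool) → Pt n → ℕ
inDegree T o D (i , j) =
  count (λ j' → D i j' j) +
  count (λ e → let ab = lookup (idEdges T) e in
                 (o e ∧ (proj₂ ab ==ᵖ (i , j))) ∨ (not (o e) ∧ (proj₁ ab ==ᵖ (i , j))))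

VandermondeCompletable : ∀ {n m} (T : Fin m → List (Pt n × Pt n)) → IdOrientation T → Set
VandermondeCompletable {n} T o =
  Σ (Fin n → Fin n → Fin n → Bool) λ D →
    (∀ i → IsTransitiveTournament (D i)) ×
    (∀ x → inDegree T o D x ≤ n ∸ 1)

module Submission where

-- For each label v take as identifier spanning tree the star centred at the occurrence of v in
-- the highest row, so every vertex p below its root sends its n - 1 identifier edges into the
-- root's row.  Order base clique i by the row of each vertex's root, higher roots first: by
-- linearity distinct non-root vertices of row i have roots in distinct rows, so a non-root vertex
-- whose root lies in row K has clique in-degree at most n - 1 - K.  Orient the identifier edge
-- from (r , a) to y = (K , t) upwards iff indeg(y) + (K - r) < n.  A vertex x = (i , j) with
-- root row K then receives at most K - i identifier edges as lower endpoint (clique in-degrees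
-- in a row are distinct) and at most one from each row r < i as upper endpoint, only when
-- indeg(x) + (i - r) < n; in either case (x its own root or not) the total is at most n - 1.

open import Defs
open import Data.Nat using (ℕ; _≤_)
open import Data.Fin using (Fin)
open import Data.Product using (Σ; _×_)
open import Data.List using (List)

open import Data.Bool using (Bool; true; false; if_then_else_; _∧_; _∨_; not)
open import Data.Bool.Properties using (¬-not; ∧-zeroʳ; not-injective)
open import Data.Empty using (⊥; ⊥-elim)
open import Data.Fin using (zero; suc; toℕ; combine) renaming (_≟_ to _≟ᶠ_)
open import Data.Fin.Properties
  using (toℕ-injective; suc-injective; toℕ<n; combine-monoˡ-<; combine-injectiveʳ; any?)
open import Data.List
  using ([]; _∷_; _++_; map; concatMap; filter; allFin; lookup; cartesianProduct; tabulate)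
open import Data.List.Membership.Propositional using (_∈_)
open import Data.List.Membership.Propositional.Properties
  using (∈-map⁻; ∈-map⁺; ∈-filter⁻; ∈-filter⁺; ∈-cartesianProduct⁺; ∈-allFin)
open import Data.List.Relation.Unary.AllPairs using ([])
open import Data.List.Relation.Unary.Unique.Propositional using (Unique)
import Data.List.Relation.Unary.Unique.Propositional.Properties as Unique
open import Data.Nat as ℕ using (zero; suc; _+_; _∸_; _<_; z≤n; s≤s; _<?_)
open import Data.Nat.Properties hiding (suc-injective)
open import Algebra.Properties.CommutativeMonoid.Sum +-0-commutativeMonoid
  using (sum; ∑-comm; ∑-distrib-+; sum-cong-≗)
open import Data.Product using (_,_; proj₁; proj₂; ∃)
import Data.Product.Properties as ×
open import Data.Sum using (_⊎_; inj₁; inj₂)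
open import Function using (_∘_; id; flip; case_of_)
open import Function.Definitions using (Injective)
open import Level using (Level; 0ℓ)
open import Relation.Binary using (tri<; tri≈; tri>)
open import Relation.Binary.Construct.Closure.ReflexiveTransitive using (Star; ε; _◅_; _◅◅_)
open import Relation.Binary.PropositionalEquality
open import Relation.Nullary using (¬_; ¬?; Dec; yes; no; does)
open import Relation.Nullary.Decidable using (⌊_⌋; _×-dec_)
open import Relation.Unary using (Pred; Decidable)

isYes⇒ : ∀ {p} {P : Set p} (P? : Dec P) → ⌊ P? ⌋ ≡ true → P
isYes⇒ (yes p) _ = p

isNo⇒ : ∀ {p} {P : Set p} (P? : Dec P) → ⌊ P? ⌋ ≡ false → ¬ P
isNo⇒ (no ¬p) _ = ¬p

⇒isYes : ∀ {p} {P : Set p} (P? : Dec P) → P → ⌊ P? ⌋ ≡ true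
⇒isYes (yes _) _ = refl
⇒isYes (no ¬p) p = ⊥-elim (¬p p)

⇒isNo : ∀ {p} {P : Set p} (P? : Dec P) → ¬ P → ⌊ P? ⌋ ≡ false
⇒isNo (yes p) ¬p = ⊥-elim (¬p p)
⇒isNo (no _) _ = refl

∧-trueˡ : ∀ {x y} → x ∧ y ≡ true → x ≡ true
∧-trueˡ {true} _ = refl

∧-trueʳ : ∀ {x y} → x ∧ y ≡ true → y ≡ true
∧-trueʳ {true} e = e

==⇒≡ : ∀ {k} {s t : Fin k} → s == t ≡ true → s ≡ t
==⇒≡ {s = s} {t} = isYes⇒ (s ≟ᶠ t)

==-refl : ∀ {k} (s : Fin k) → s == s ≡ true
==-refl s = ⇒isYes (s ≟ᶠ s) refl

==ᵖ⇒≡ : ∀ {n} {p q : Pt n} → p ==ᵖ q ≡ true → p ≡ q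
==ᵖ⇒≡ {p = p} {q} = isYes⇒ (×.≡-dec _≟ᶠ_ _≟ᶠ_ p q)

ind : Bool → ℕ
ind b = if b then 1 else 0

-- Sums and counts over Fin k

sum-mono-≤ : ∀ {k} {f g : Fin k → ℕ} → (∀ t → f t ≤ g t) → sum f ≤ sum g
sum-mono-≤ {zero} _ = z≤n
sum-mono-≤ {suc k} f≤g = +-mono-≤ (f≤g zero) (sum-mono-≤ (f≤g ∘ suc))

sum-mono-< : ∀ {k} {f g : Fin k → ℕ} → (∀ t → f t ≤ g t) → ∀ w → f w < g w → sum f < sum g
sum-mono-< {suc k} f≤g zero fw<gw = +-mono-<-≤ fw<gw (sum-mono-≤ (f≤g ∘ suc))
sum-mono-< {suc k} f≤g (suc w) fw<gw = +-mono-≤-< (f≤g zero) (sum-mono-< (f≤g ∘ suc) w fw<gw)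

sum-zero : ∀ {k} {f : Fin k → ℕ} → (∀ t → f t ≡ 0) → sum f ≡ 0
sum-zero {zero} _ = refl
sum-zero {suc k} {f} f≡0 rewrite f≡0 zero = sum-zero (f≡0 ∘ suc)

sum-single : ∀ {k} {f : Fin k → ℕ} w → (∀ t → t ≢ w → f t ≡ 0) → sum f ≡ f w
sum-single {suc k} {f} zero off =
  trans (cong (f zero +_) (sum-zero λ t → off (suc t) λ ())) (+-identityʳ (f zero))
sum-single {suc k} (suc w) off rewrite off zero (λ ()) =
  sum-single w λ t t≢w → off (suc t) (t≢w ∘ suc-injective)

sum-if== : ∀ {k} (s : Fin k) x → sum (λ t → if s == t then x else 0) ≡ x
sum-if== s x =
  trans (sum-single s λ t t≢s → cong (λ b → if b then x else 0) (⇒isNo (s ≟ᶠ t) (t≢s ∘ sym)))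
        (cong (λ b → if b then x else 0) (==-refl s))

∑ₚ : ∀ {n} → (Pt n → ℕ) → ℕ
∑ₚ f = sum (λ r → sum (λ a → f (r , a)))

∑ₚ-if==ᵖ : ∀ {n} (x : Pt n) (f : Pt n → ℕ) → ∑ₚ (λ p → if p ==ᵖ x then f p else 0) ≡ f x
∑ₚ-if==ᵖ (i , j) f = begin
  ∑ₚ g
    ≡⟨ sum-cong-≗ (λ r → sum-single {f = λ a → g (r , a)} j λ a a≢j → off (a≢j ∘ cong proj₂)) ⟩
  sum (λ r → g (r , j))
    ≡⟨ sum-single {f = λ r → g (r , j)} i (λ r r≢i → off (r≢i ∘ cong proj₁)) ⟩
  g (i , j)
    ≡⟨ cong (λ b → if b then f (i , j) else 0) (⇒isYes (≡-dec (i , j) (i , j)) refl) ⟩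
  f (i , j) ∎
  where
  open ≡-Reasoning
  ≡-dec = ×.≡-dec _≟ᶠ_ _≟ᶠ_
  g : Pt _ → ℕ
  g p = if p ==ᵖ (i , j) then f p else 0
  off : ∀ {p} → p ≢ (i , j) → g p ≡ 0
  off {p} p≢x = cong (λ b → if b then f p else 0) (⇒isNo (≡-dec p (i , j)) p≢x)

count≡sum : ∀ {k} (f : Fin k → Bool) → count f ≡ sum (ind ∘ f)
count≡sum {zero} f = refl
count≡sum {suc k} f = cong (ind (f zero) +_) (count≡sum (f ∘ suc))

ind-mono : ∀ {a b} → (a ≡ true → b ≡ true) → ind a ≤ ind b
ind-mono {false} _ = z≤n
ind-mono {true} a⇒b rewrite a⇒b refl = ≤-refl

module _ {k : ℕ} where

  count-mono : {f g : Fin k → Bool} → (∀ t → f t ≡ true → g t ≡ true) → count f ≤ count g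
  count-mono {f} {g} f⇒g rewrite count≡sum f | count≡sum g = sum-mono-≤ (ind-mono ∘ f⇒g)

  count-mono-< : {f g : Fin k → Bool} → (∀ t → f t ≡ true → g t ≡ true) →
    ∀ w → f w ≡ false → g w ≡ true → count f < count g
  count-mono-< {f} {g} f⇒g w fw gw rewrite count≡sum f | count≡sum g =
    sum-mono-< (ind-mono ∘ f⇒g) w (subst₂ (λ a b → ind a < ind b) (sym fw) (sym gw) ≤-refl)

  count-true : count {k} (λ _ → true) ≡ k
  count-true = trans (count≡sum {k} (λ _ → true)) (sum-ones k)
    where
    sum-ones : ∀ k → sum {k} (λ _ → 1) ≡ k
    sum-ones zero = refl
    sum-ones (suc k) = cong suc (sum-ones k)

  count-< : (f : Fin k → Bool) → ∀ w → f w ≡ false → count f < k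
  count-< f w fw = subst (count f <_) count-true (count-mono-< (λ _ _ → refl) w fw refl)

  count-none : {f : Fin k → Bool} → (∀ t → f t ≢ true) → count f ≡ 0
  count-none {f} none rewrite count≡sum f = sum-zero (cong ind ∘ ¬-not ∘ none)

  count-∨ : (f g : Fin k → Bool) → count (λ t → f t ∨ g t) ≤ count f + count g
  count-∨ f g rewrite count≡sum (λ t → f t ∨ g t) | count≡sum f | count≡sum g =
    ≤-trans (sum-mono-≤ (λ t → ind-∨ (f t) (g t))) (≤-reflexive (∑-distrib-+ (ind ∘ f) (ind ∘ g)))
    where
    ind-∨ : ∀ a b → ind (a ∨ b) ≤ ind a + ind b
    ind-∨ false b = ≤-refl
    ind-∨ true b = s≤s z≤n

AtMostOne : ∀ {k} → (Fin k → Bool) → Set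
AtMostOne f = ∀ s t → f s ≡ true → f t ≡ true → s ≡ t

count-≤-1 : ∀ {k} (f : Fin k → Bool) → AtMostOne f → count f ≤ 1
count-≤-1 {zero} f _ = z≤n
count-≤-1 {suc k} f one with f zero in f0
... | true = ≤-reflexive (cong suc (count-none λ t ft → case one zero (suc t) f0 ft of λ ()))
... | false = count-≤-1 (f ∘ suc) λ s t fs ft → suc-injective (one (suc s) (suc t) fs ft)

count-≤-ind : ∀ {k} (f : Fin k → Bool) (c : Bool) → AtMostOne f → (∀ t → f t ≡ true → c ≡ true) →
  count f ≤ ind c
count-≤-ind f true one _ = count-≤-1 f one
count-≤-ind f false _ f⇒c = ≤-reflexive (count-none λ t ft → case f⇒c t ft of λ ())

InjectiveOn : ∀ {k} → (Fin k → Bool) → (Fin k → ℕ) → Set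
InjectiveOn f φ = ∀ s t → f s ≡ true → f t ≡ true → φ s ≡ φ t → s ≡ t

count-injective-< : ∀ {k} (f : Fin k → Bool) (φ : Fin k → ℕ) b → InjectiveOn f φ →
  (∀ t → f t ≡ true → φ t < b) → count f ≤ b
count-injective-< f φ zero _ φ<0 = ≤-reflexive (count-none λ t ft → n≮0 (φ<0 t ft))
count-injective-< f φ (suc b) φ-inj φ<1+b = begin
  count f                    ≤⟨ count-mono split ⟩
  count (λ t → f<b t ∨ f≡b t) ≤⟨ count-∨ f<b f≡b ⟩
  count f<b + count f≡b       ≤⟨ +-mono-≤ below-b at-b ⟩
  b + 1                       ≡⟨ +-comm b 1 ⟩
  suc b                       ∎
  where
  open ≤-Reasoning
  f<b f≡b : _ → Bool
  f<b t = f t ∧ ⌊ φ t <? b ⌋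
  f≡b t = f t ∧ ⌊ φ t ℕ.≟ b ⌋
  split : ∀ t → f t ≡ true → f<b t ∨ f≡b t ≡ true
  split t ft rewrite ft with φ t <? b | φ t ℕ.≟ b
  ... | yes _ | _ = refl
  ... | no _ | yes _ = refl
  ... | no φ≮b | no φ≢b = ⊥-elim (φ≢b (≤-antisym (≤-pred (φ<1+b t ft)) (≮⇒≥ φ≮b)))
  below-b : count f<b ≤ b
  below-b = count-injective-< f<b φ b
    (λ s t fs ft → φ-inj s t (∧-trueˡ fs) (∧-trueˡ ft))
    (λ t ft → isYes⇒ (φ t <? b) (∧-trueʳ {f t} ft))
  at-b : count f≡b ≤ 1
  at-b = count-≤-1 f≡b λ s t fs ft → φ-inj s t (∧-trueˡ fs) (∧-trueˡ ft)
    (trans (isYes⇒ (φ s ℕ.≟ b) (∧-trueʳ {f s} fs)) (sym (isYes⇒ (φ t ℕ.≟ b) (∧-trueʳ {f t} ft))))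

count-injective : ∀ {k} (f : Fin k → Bool) (φ : Fin k → ℕ) a b → InjectiveOn f φ →
  (∀ t → f t ≡ true → a ≤ φ t × φ t < b) → count f ≤ b ∸ a
count-injective f φ a b φ-inj φ-range = count-injective-< f (λ t → φ t ∸ a) (b ∸ a)
  (λ s t fs ft eq → φ-inj s t fs ft (∸-cancelʳ-≡ (proj₁ (φ-range s fs)) (proj₁ (φ-range t ft)) eq))
  (λ t ft → ∸-monoˡ-< (proj₂ (φ-range t ft)) (proj₁ (φ-range t ft)))

-- Sums over lists

private variable
  a b : Level
  A : Set a
  B : Set b

∑ₗ : (A → ℕ) → List A → ℕ
∑ₗ w [] = 0
∑ₗ w (x ∷ xs) = w x + ∑ₗ w xs

∑ₗ-++ : (w : A → ℕ) (xs ys : List A) → ∑ₗ w (xs ++ ys) ≡ ∑ₗ w xs + ∑ₗ w ys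
∑ₗ-++ w [] ys = refl
∑ₗ-++ w (x ∷ xs) ys = trans (cong (w x +_) (∑ₗ-++ w xs ys)) (sym (+-assoc (w x) _ _))

∑ₗ-concatMap : (w : B → ℕ) (f : A → List B) (xs : List A) →
  ∑ₗ w (concatMap f xs) ≡ ∑ₗ (∑ₗ w ∘ f) xs
∑ₗ-concatMap w f [] = refl
∑ₗ-concatMap w f (x ∷ xs) =
  trans (∑ₗ-++ w (f x) (concatMap f xs)) (cong (∑ₗ w (f x) +_) (∑ₗ-concatMap w f xs))

∑ₗ-map : (w : B → ℕ) (f : A → B) (xs : List A) → ∑ₗ w (map f xs) ≡ ∑ₗ (w ∘ f) xs
∑ₗ-map w f [] = refl
∑ₗ-map w f (x ∷ xs) = cong (w (f x) +_) (∑ₗ-map w f xs)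

∑ₗ-cartesianProduct : (w : A × B → ℕ) (xs : List A) (ys : List B) →
  ∑ₗ w (cartesianProduct xs ys) ≡ ∑ₗ (λ x → ∑ₗ (λ y → w (x , y)) ys) xs
∑ₗ-cartesianProduct w [] ys = refl
∑ₗ-cartesianProduct w (x ∷ xs) ys = trans (∑ₗ-++ w (map (x ,_) ys) _)
  (cong₂ _+_ (∑ₗ-map w (x ,_) ys) (∑ₗ-cartesianProduct w xs ys))

∑ₗ-filter : ∀ {p} {P : Pred A p} (P? : Decidable P) (w : A → ℕ) (xs : List A) →
  ∑ₗ w (filter P? xs) ≡ ∑ₗ (λ x → if does (P? x) then w x else 0) xs
∑ₗ-filter P? w [] = refl
∑ₗ-filter P? w (x ∷ xs) with does (P? x)
... | true = cong (w x +_) (∑ₗ-filter P? w xs)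
... | false = ∑ₗ-filter P? w xs

∑ₗ-filter-≤ : ∀ {p} {P : Pred A p} (P? : Decidable P) (w : A → ℕ) (xs : List A) →
  ∑ₗ w (filter P? xs) ≤ ∑ₗ w xs
∑ₗ-filter-≤ P? w [] = z≤n
∑ₗ-filter-≤ P? w (x ∷ xs) with does (P? x)
... | true = +-monoʳ-≤ (w x) (∑ₗ-filter-≤ P? w xs)
... | false = ≤-trans (∑ₗ-filter-≤ P? w xs) (m≤n+m _ (w x))

∑ₗ-tabulate : ∀ {k} (w : A → ℕ) (f : Fin k → A) → ∑ₗ w (tabulate f) ≡ sum (w ∘ f)
∑ₗ-tabulate {k = zero} w f = refl
∑ₗ-tabulate {k = suc k} w f = cong (w (f zero) +_) (∑ₗ-tabulate w (f ∘ suc))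

∑ₗ-allFin : ∀ {k} (w : Fin k → ℕ) → ∑ₗ w (allFin k) ≡ sum w
∑ₗ-allFin w = ∑ₗ-tabulate w id

count-lookup : (g : A → Bool) (xs : List A) →
  count (g ∘ lookup xs) ≡ ∑ₗ (ind ∘ g) xs
count-lookup g [] = refl
count-lookup g (x ∷ xs) = cong (ind (g x) +_) (count-lookup g xs)

data Greatest {k p} (P : Pred (Fin k) p) : Set p where
  none     : (∀ t → ¬ P t) → Greatest P
  greatest : ∀ t → P t → (∀ s → P s → toℕ s ≤ toℕ t) → Greatest P

greatest? : ∀ {k p} {P : Pred (Fin k) p} → Decidable P → Greatest P
greatest? {zero} P? = none λ ()
greatest? {suc k} P? with greatest? (P? ∘ suc)
... | greatest t Pt max = greatest (suc t) Pt λ { zero _ → z≤n ; (suc s) Ps → s≤s (max s Ps) }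
... | none ¬P with P? zero
...   | yes P0 = greatest zero P0 λ { zero _ → z≤n ; (suc s) Ps → ⊥-elim (¬P s Ps) }
...   | no ¬P0 = none λ { zero → ¬P0 ; (suc s) → ¬P s }

-- Transitive tournaments

losses : ∀ {k} → (Fin k → Fin k → Bool) → Fin k → ℕ
losses D t = count (λ s → D s t)

module _ {k : ℕ} {D : Fin k → Fin k → Bool} (tournament : IsTransitiveTournament D) where

  private
    irreflexive = proj₁ (proj₂ tournament)
    transitive = proj₂ (proj₂ tournament)

  losses-mono-< : ∀ {s t} → D s t ≡ true → losses D s < losses D t
  losses-mono-< {s} {t} Dst = count-mono-< (λ r Drs → transitive r s t Drs Dst) s (irreflexive s) Dst

  losses-injective : Injective _≡_ _≡_ (losses D)
  losses-injective {s} {t} eq with s ≟ᶠ t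
  ... | yes s≡t = s≡t
  ... | no s≢t with proj₁ tournament s t s≢t
  ...   | inj₁ (Dst , _) = ⊥-elim (<-irrefl eq (losses-mono-< Dst))
  ...   | inj₂ (_ , Dts) = ⊥-elim (<-irrefl (sym eq) (losses-mono-< Dts))

  losses-< : ∀ t → losses D t < k
  losses-< t = count-< (λ s → D s t) t (irreflexive t)

byRank : ∀ {k} → (Fin k → ℕ) → Fin k → Fin k → Bool
byRank rank s t = ⌊ rank t <? rank s ⌋

byRank-isTransitiveTournament : ∀ {k} {rank : Fin k → ℕ} → Injective _≡_ _≡_ rank →
  IsTransitiveTournament (byRank rank)
byRank-isTransitiveTournament {rank = rank} rank-injective =
  total , (λ t → ⇒isNo (rank t <? rank t) (<-irrefl refl)) , transitive
  where
  total : ∀ s t → s ≢ t →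
    (byRank rank s t ≡ true × byRank rank t s ≡ false) ⊎
    (byRank rank s t ≡ false × byRank rank t s ≡ true)
  total s t s≢t with <-cmp (rank s) (rank t)
  ... | tri< s<t s≢t' t≮s = inj₂ (⇒isNo (rank t <? rank s) t≮s , ⇒isYes (rank s <? rank t) s<t)
  ... | tri≈ _ eq _ = ⊥-elim (s≢t (rank-injective eq))
  ... | tri> s≮t _ t<s = inj₁ (⇒isYes (rank t <? rank s) t<s , ⇒isNo (rank s <? rank t) s≮t)
  transitive : ∀ r s t → byRank rank r s ≡ true → byRank rank s t ≡ true → byRank rank r t ≡ true
  transitive r s t rs st =
    ⇒isYes (rank t <? rank r) (<-trans (isYes⇒ (rank t <? rank s) st) (isYes⇒ (rank s <? rank r) rs))

module _ {n} {E : List (Pt n × Pt n)} (q : Pt n) (through-q : ∀ {x y} → Adj E x y → x ≡ q ⊎ y ≡ q)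
  where

  middle≡centre : ∀ {k} {xs : Fin k → Pt n} → Injective _≡_ _≡_ xs → ∀ {a b c} → a ≢ c →
    Adj E (xs a) (xs b) → Adj E (xs b) (xs c) → xs b ≡ q
  middle≡centre xs-inj a≢c ab bc with through-q ab | through-q bc
  ... | inj₂ xb≡q | _ = xb≡q
  ... | inj₁ _ | inj₁ xb≡q = xb≡q
  ... | inj₁ xa≡q | inj₂ xc≡q = ⊥-elim (a≢c (xs-inj (trans xa≡q (sym xc≡q))))

  commonVertex⇒¬Cycle : ¬ Cycle E
  commonVertex⇒¬Cycle (zero , xs , xs-inj , adjacent , closing) =
    case xs-inj (trans (middle≡centre xs-inj (λ ()) (adjacent zero) (adjacent (suc zero)))
                  (sym (middle≡centre xs-inj (λ ()) (adjacent (suc zero)) closing))) of λ ()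
  commonVertex⇒¬Cycle (suc k , xs , xs-inj , adjacent , closing) =
    case xs-inj (trans (middle≡centre xs-inj (λ ()) (adjacent zero) (adjacent (suc zero)))
                  (sym (middle≡centre xs-inj (λ ()) (adjacent (suc zero))
                                                     (adjacent (suc (suc zero)))))) of λ ()

module Construction {n m : ℕ} (lab : Fin n → Fin n → Fin m) (uniform : Uniform lab) (linear : Linear lab)
  where

  label : Pt n → Fin m
  label (i , j) = lab i j

  row : Pt n → Fin n
  row = proj₁

  OccursIn : Fin m → Pred (Fin n) 0ℓ
  OccursIn v K = ∃ λ l → lab K l ≡ v

  topRow : ∀ v → Greatest (OccursIn v)
  topRow v = greatest? (λ K → any? (λ l → lab K l ≟ᶠ v))

  points : List (Pt n)
  points = cartesianProduct (allFin n) (allFin n)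

  LabelledBelow : Fin m → Pt n → Pred (Pt n) 0ℓ
  LabelledBelow v q p = label p ≡ v × toℕ (row p) < toℕ (row q)

  labelledBelow? : ∀ v q → Decidable (LabelledBelow v q)
  labelledBelow? v q p = (label p ≟ᶠ v) ×-dec (toℕ (row p) <? toℕ (row q))

  star : Fin m → Pt n → List (Pt n × Pt n)
  star v q = map (_, q) (filter (labelledBelow? v q) points)

  ∈-star⁻ : ∀ {v q p q'} → (p , q') ∈ star v q → q' ≡ q × LabelledBelow v q p
  ∈-star⁻ {v} {q} p∈ with ∈-map⁻ (_, q) {xs = filter (labelledBelow? v q) points} p∈
  ... | p , p∈′ , refl = refl , proj₂ (∈-filter⁻ (labelledBelow? v q) {xs = points} p∈′)

  module _ {v q} (q-label : label q ≡ v) (q-top : ∀ p → label p ≡ v → toℕ (row p) ≤ toℕ (row q)) where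

    centre⊎∈star : ∀ p → label p ≡ v → p ≡ q ⊎ (p , q) ∈ star v q
    centre⊎∈star p p-label with toℕ (row p) <? toℕ (row q)
    ... | yes p<q = inj₂ (∈-map⁺ (_, q) (∈-filter⁺ (labelledBelow? v q) p∈points (p-label , p<q)))
      where
      p∈points = ∈-cartesianProduct⁺ (∈-allFin (proj₁ p)) (∈-allFin (proj₂ p))
    ... | no p≮q with toℕ-injective (≤-antisym (q-top p p-label) (≮⇒≥ p≮q))
    ...   | refl = inj₁ (cong (row p ,_) (uniform (row p) (trans p-label (sym q-label))))

    star-isSpanningTree : IsIdentifierSpanningTree lab v (star v q)
    star-isSpanningTree = edge-labels , unique , connected , commonVertex⇒¬Cycle q through-q
      where
      edge-labels : ∀ {a b} → (a , b) ∈ star v q →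
        LabelledBy lab v a × LabelledBy lab v b × toℕ (row a) < toℕ (row b)
      edge-labels ab∈ with ∈-star⁻ ab∈
      ... | refl , a-label , a<b = a-label , q-label , a<b
      unique : Unique (star v q)
      unique = Unique.map⁺ (cong proj₁)
        (Unique.filter⁺ (labelledBelow? v q)
          (Unique.cartesianProduct⁺ (Unique.allFin⁺ n) (Unique.allFin⁺ n)))
      through-q : ∀ {x y} → Adj (star v q) x y → x ≡ q ⊎ y ≡ q
      through-q (inj₁ xy∈) = inj₂ (proj₁ (∈-star⁻ xy∈))
      through-q (inj₂ yx∈) = inj₁ (proj₁ (∈-star⁻ yx∈))
      to-centre : ∀ a → label a ≡ v → Star (Adj (star v q)) a q
      to-centre a a-label with centre⊎∈star a a-label
      ... | inj₁ refl = ε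
      ... | inj₂ aq∈ = inj₁ aq∈ ◅ ε
      from-centre : ∀ a → label a ≡ v → Star (Adj (star v q)) q a
      from-centre a a-label with centre⊎∈star a a-label
      ... | inj₁ refl = ε
      ... | inj₂ aq∈ = inj₂ aq∈ ◅ ε
      connected : ∀ a b → label a ≡ v → label b ≡ v → Star (Adj (star v q)) a b
      connected a b a-label b-label = to-centre a a-label ◅◅ from-centre b b-label

  tree : Fin m → List (Pt n × Pt n)
  tree v with topRow v
  ... | none _ = []
  ... | greatest K (l , _) _ = star v (K , l)

  tree-isSpanningTree : ∀ v → IsIdentifierSpanningTree lab v (tree v)
  tree-isSpanningTree v with topRow v
  ... | greatest K (l , lab≡v) top =
    star-isSpanningTree lab≡v λ p p-label → top (row p) (proj₂ p , p-label)
  ... | none absent = (λ ()) , [] , (λ a _ a-label _ → ⊥-elim (absent (row a) (proj₂ a , a-label))) ,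
        λ (_ , _ , _ , adjacent , _) → case adjacent zero of λ { (inj₁ ()) ; (inj₂ ()) }

  root : Pt n → Pt n
  root p with topRow (label p)
  ... | greatest K (l , _) _ = K , l
  ... | none absent = ⊥-elim (absent (row p) (proj₂ p , refl))

  label-root : ∀ p → label (root p) ≡ label p
  label-root p with topRow (label p)
  ... | greatest K (l , lab≡v) _ = lab≡v
  ... | none absent = ⊥-elim (absent (row p) (proj₂ p , refl))

  root-top : ∀ p p′ → label p′ ≡ label p → toℕ (row p′) ≤ toℕ (row (root p))
  root-top p p′ same-label with topRow (label p)
  ... | greatest K _ top = top (row p′) (proj₂ p′ , same-label)
  ... | none absent = ⊥-elim (absent (row p) (proj₂ p , refl))

  root-unique : ∀ p q → label q ≡ label p → (∀ p′ → label p′ ≡ label p → toℕ (row p′) ≤ toℕ (row q)) →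
    root p ≡ q
  root-unique p q q-label q-top
    with toℕ-injective (≤-antisym (q-top (root p) (label-root p)) (root-top p q q-label))
  ... | refl = cong (row q ,_) (uniform (row q) (trans (label-root p) (sym q-label)))

  rootRow : Pt n → Fin n
  rootRow = row ∘ root

  rootRow-injective : ∀ {i s t} → toℕ i < toℕ (rootRow (i , s)) →
    rootRow (i , s) ≡ rootRow (i , t) → s ≡ t
  rootRow-injective {i} {s} {t} i<K same-row
    with root (i , s) | root (i , t) | label-root (i , s) | label-root (i , t)
  ... | K , l | K′ , l′ | lab≡s | lab≡t with refl ← same-row =
    linear i K (λ { refl → <-irrefl refl i<K }) s t l l′ (sym lab≡s) (sym lab≡t)

  -- combine K s = K * n + s: ordered by root row, ties broken by column.
  rank : Fin n → Fin n → ℕ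
  rank i s = toℕ (combine (rootRow (i , s)) s)

  clique : Fin n → Fin n → Fin n → Bool
  clique i = byRank (rank i)

  clique-isTransitiveTournament : ∀ i → IsTransitiveTournament (clique i)
  clique-isTransitiveTournament i =
    byRank-isTransitiveTournament λ {s} {t} eq →
      combine-injectiveʳ (rootRow (i , s)) s (rootRow (i , t)) t (toℕ-injective eq)

  cliqueInDegree : Pt n → ℕ
  cliqueInDegree (i , j) = losses (clique i) j

  beats⇒rootRow-≥ : ∀ {i s j} → clique i s j ≡ true → toℕ (rootRow (i , j)) ≤ toℕ (rootRow (i , s))
  beats⇒rootRow-≥ {i} {s} {j} s-beats-j = ≮⇒≥ λ s-lower →
    <-asym (isYes⇒ (rank i j <? rank i s) s-beats-j) (combine-monoˡ-< s j s-lower)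

  cliqueInDegree-belowRoot : ∀ {i j} → toℕ i < toℕ (rootRow (i , j)) →
    cliqueInDegree (i , j) ≤ n ∸ suc (toℕ (rootRow (i , j)))
  cliqueInDegree-belowRoot {i} {j} i<K =
    count-injective (λ s → clique i s j) (toℕ ∘ rootRow ∘ (i ,_)) _ n injective range
    where
    range : ∀ s → clique i s j ≡ true →
      toℕ (rootRow (i , j)) < toℕ (rootRow (i , s)) × toℕ (rootRow (i , s)) < n
    range s s-beats-j = ≤∧≢⇒< (beats⇒rootRow-≥ s-beats-j) distinct , toℕ<n (rootRow (i , s))
      where
      distinct : toℕ (rootRow (i , j)) ≢ toℕ (rootRow (i , s))
      distinct eq with refl ← rootRow-injective i<K (toℕ-injective eq) =
        case trans (sym s-beats-j) (proj₁ (proj₂ (clique-isTransitiveTournament i)) j) of λ ()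
    injective : InjectiveOn (λ s → clique i s j) (toℕ ∘ rootRow ∘ (i ,_))
    injective s t s-beats-j _ eq =
      rootRow-injective (<-≤-trans i<K (beats⇒rootRow-≥ s-beats-j)) (toℕ-injective eq)

  towardsUpper : Fin n → Pt n → Bool
  towardsUpper r y = ⌊ cliqueInDegree y + (toℕ (row y) ∸ toℕ r) <? n ⌋

  orient : Pt n × Pt n → Bool
  orient (p , y) = towardsUpper (row p) y

  orientation : IdOrientation tree
  orientation e = orient (lookup (idEdges tree) e)

  pointsTo : Pt n → Pt n × Pt n → Bool
  pointsTo x (p , y) = (orient (p , y) ∧ (y ==ᵖ x)) ∨ (not (orient (p , y)) ∧ (p ==ᵖ x))

  lowerShare : Pt n → Pt n → ℕ → ℕ
  lowerShare x p d = if p ==ᵖ x then d else 0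

  idEdgesOf-pointsTo : ∀ x p K l → ∑ₗ (ind ∘ pointsTo x) (idEdgesOf (p , (K , l))) ≤
    ind ((K == row x) ∧ towardsUpper (row p) x) + lowerShare x p (toℕ K ∸ toℕ (row p))
  idEdgesOf-pointsTo x p K l = begin
    ∑ₗ (ind ∘ pointsTo x) (map edge (filter (λ t → ¬? (t ≟ᶠ l)) (allFin n)))
      ≡⟨ ∑ₗ-map (ind ∘ pointsTo x) edge (filter (λ t → ¬? (t ≟ᶠ l)) (allFin n)) ⟩
    ∑ₗ (ind ∘ pointsTo x ∘ edge) (filter (λ t → ¬? (t ≟ᶠ l)) (allFin n))
      ≤⟨ ∑ₗ-filter-≤ (λ t → ¬? (t ≟ᶠ l)) (ind ∘ pointsTo x ∘ edge) (allFin n) ⟩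
    ∑ₗ (ind ∘ pointsTo x ∘ edge) (allFin n)
      ≡⟨ trans (∑ₗ-allFin (ind ∘ pointsTo x ∘ edge)) (sym (count≡sum (pointsTo x ∘ edge))) ⟩
    count (pointsTo x ∘ edge)
      ≤⟨ count-∨ up down ⟩
    count up + count down
      ≤⟨ +-mono-≤ up-bound down-bound ⟩
    ind ((K == row x) ∧ towardsUpper (row p) x) + lowerShare x p d ∎
    where
    open ≤-Reasoning
    edge : Fin n → Pt n × Pt n
    edge t = p , (K , t)
    d = toℕ K ∸ toℕ (row p)
    up down : Fin n → Bool
    up t = orient (edge t) ∧ ((K , t) ==ᵖ x)
    down t = not (orient (edge t)) ∧ (p ==ᵖ x)
    up-bound : count up ≤ ind ((K == row x) ∧ towardsUpper (row p) x)
    up-bound = count-≤-ind up _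
      (λ s t s-up t-up → cong proj₂ (trans (at-x s s-up) (sym (at-x t t-up))))
      (λ t t-up → case at-x t t-up of λ { refl → cong₂ _∧_ (==-refl K) (∧-trueˡ t-up) })
      where
      at-x : ∀ t → up t ≡ true → (K , t) ≡ x
      at-x t t-up = ==ᵖ⇒≡ (∧-trueʳ {orient (edge t)} t-up)
    down-bound : count down ≤ lowerShare x p d
    down-bound = bound (p ==ᵖ x)
      where
      bound : ∀ b → count (λ t → not (orient (edge t)) ∧ b) ≤ (if b then d else 0)
      bound false = ≤-reflexive (count-none {f = λ t → not (orient (edge t)) ∧ false}
        λ t down-t → case trans (sym down-t) (∧-zeroʳ (not (orient (edge t)))) of λ ())
      bound true = subst (count (λ t → not (orient (edge t)) ∧ true) ≤_) (m∸[m∸n]≡n d≤n)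
        (count-injective (λ t → not (orient (edge t)) ∧ true) (λ t → cliqueInDegree (K , t)) (n ∸ d) n
          (λ s t _ _ → losses-injective (clique-isTransitiveTournament K))
          (λ t down-t → many-losses t down-t , losses-< (clique-isTransitiveTournament K) t))
        where
        d≤n : d ≤ n
        d≤n = ≤-trans (m∸n≤m (toℕ K) (toℕ (row p))) (<⇒≤ (toℕ<n K))
        many-losses : ∀ t → not (orient (edge t)) ∧ true ≡ true → n ∸ d ≤ cliqueInDegree (K , t)
        many-losses t down-t =
          ≤-trans (∸-monoˡ-≤ d (≮⇒≥ (isNo⇒ (_ <? n) (not-injective (∧-trueˡ down-t)))))
          (≤-reflexive (m+n∸n≡m (cliqueInDegree (K , t)) d))

  -- Zero exactly when p is its own root (truncated subtraction).
  height : Pt n → ℕ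
  height p = toℕ (rootRow p) ∸ toℕ (row p)

  BelowRoot : Pred (Pt n) 0ℓ
  BelowRoot p = toℕ (row p) < toℕ (rootRow p)

  belowRoot? : Decidable BelowRoot
  belowRoot? p = toℕ (row p) <? toℕ (rootRow p)

  rootedWeight : (Pt n × Pt n → ℕ) → Pt n → ℕ
  rootedWeight w p = if ⌊ belowRoot? p ⌋ then w (p , root p) else 0

  ∑ₗ-star : ∀ w {v q} → label q ≡ v → (∀ p → label p ≡ v → toℕ (row p) ≤ toℕ (row q)) →
    ∑ₗ w (star v q) ≤ ∑ₚ (λ p → if label p == v then rootedWeight w p else 0)
  ∑ₗ-star w {v} {q} q-label q-top = begin
    ∑ₗ w (map (_, q) (filter (labelledBelow? v q) points))
      ≡⟨ ∑ₗ-map w (_, q) (filter (labelledBelow? v q) points) ⟩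
    ∑ₗ (w ∘ (_, q)) (filter (labelledBelow? v q) points)
      ≡⟨ ∑ₗ-filter (labelledBelow? v q) (w ∘ (_, q)) points ⟩
    ∑ₗ starWeight points
      ≡⟨ ∑ₗ-cartesianProduct starWeight (allFin n) (allFin n) ⟩
    ∑ₗ (λ r → ∑ₗ (λ a → starWeight (r , a)) (allFin n)) (allFin n)
      ≡⟨ trans (∑ₗ-allFin (λ r → ∑ₗ (λ a → starWeight (r , a)) (allFin n)))
               (sum-cong-≗ λ r → ∑ₗ-allFin (λ a → starWeight (r , a))) ⟩
    ∑ₚ starWeight
      ≤⟨ sum-mono-≤ (λ r → sum-mono-≤ λ a → starWeight≤ (r , a) (labelledBelow? v q (r , a))) ⟩
    ∑ₚ (λ p → if label p == v then rootedWeight w p else 0) ∎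
    where
    open ≤-Reasoning
    starWeight : Pt n → ℕ
    starWeight p = if does (labelledBelow? v q p) then w (p , q) else 0
    starWeight≤ : ∀ p (below? : Dec (LabelledBelow v q p)) →
      (if does below? then w (p , q) else 0) ≤ (if label p == v then rootedWeight w p else 0)
    starWeight≤ p (no _) = z≤n
    starWeight≤ p (yes (p-label , p<q))
      with refl ← root-unique p q (trans q-label (sym p-label)) (λ p′ → q-top p′ ∘ flip trans p-label)
      rewrite ⇒isYes (label p ≟ᶠ v) p-label | ⇒isYes (belowRoot? p) p<q = ≤-refl

  ∑ₗ-tree : ∀ w v → ∑ₗ w (tree v) ≤ ∑ₚ (λ p → if label p == v then rootedWeight w p else 0)
  ∑ₗ-tree w v with topRow v
  ... | greatest K (l , lab≡v) top = ∑ₗ-star w lab≡v λ p p-label → top (row p) (proj₂ p , p-label)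
  ... | none _ = z≤n

  ∑-trees : ∀ w → sum (λ v → ∑ₗ w (tree v)) ≤ ∑ₚ (rootedWeight w)
  ∑-trees w = begin
    sum (λ v → ∑ₗ w (tree v))
      ≤⟨ sum-mono-≤ (∑ₗ-tree w) ⟩
    sum (λ v → ∑ₚ (λ p → selected v p))
      ≡⟨ ∑-comm (λ v r → sum λ a → selected v (r , a)) ⟩
    sum (λ r → sum (λ v → sum λ a → selected v (r , a)))
      ≡⟨ sum-cong-≗ (λ r → ∑-comm (λ v a → selected v (r , a))) ⟩
    sum (λ r → sum (λ a → sum λ v → selected v (r , a)))
      ≡⟨ sum-cong-≗ (λ r → sum-cong-≗ λ a → sum-if== (lab r a) (rootedWeight w (r , a))) ⟩
    ∑ₚ (rootedWeight w) ∎
    where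
    open ≤-Reasoning
    selected : Fin m → Pt n → ℕ
    selected v p = if label p == v then rootedWeight w p else 0

  crossing : Pt n → Fin n → Bool
  crossing x r = ⌊ toℕ r <? toℕ (row x) ⌋ ∧ towardsUpper r x

  crossings : Pt n → ℕ
  crossings x = count (crossing x)

  crossings-≤-row : ∀ x → crossings x ≤ toℕ (row x)
  crossings-≤-row x = count-injective (crossing x) toℕ 0 (toℕ (row x)) (λ s t _ _ → toℕ-injective)
    λ r r-crossing → z≤n , isYes⇒ (toℕ r <? toℕ (row x)) (∧-trueˡ r-crossing)

  crossings-≤-free : ∀ x → crossings x ≤ (n ∸ cliqueInDegree x) ∸ 1
  crossings-≤-free x = count-injective (crossing x) gap 1 (n ∸ cliqueInDegree x) injective range
    where
    gap : Fin n → ℕ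
    gap r = toℕ (row x) ∸ toℕ r
    below : ∀ r → crossing x r ≡ true → toℕ r < toℕ (row x)
    below r r-crossing = isYes⇒ (toℕ r <? toℕ (row x)) (∧-trueˡ r-crossing)
    injective : InjectiveOn (crossing x) gap
    injective s t s-crossing t-crossing eq =
      toℕ-injective (∸-cancelˡ-≡ (<⇒≤ (below s s-crossing)) (<⇒≤ (below t t-crossing)) eq)
    range : ∀ r → crossing x r ≡ true → 1 ≤ gap r × gap r < n ∸ cliqueInDegree x
    range r r-crossing = m<n⇒0<n∸m (below r r-crossing) ,
      subst (_< n ∸ cliqueInDegree x) (m+n∸m≡n (cliqueInDegree x) (gap r))
        (∸-monoˡ-< (isYes⇒ (_ <? n) (∧-trueʳ {⌊ toℕ r <? toℕ (row x) ⌋} r-crossing)) (m≤m+n _ (gap r)))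

  upperCrossing : Pt n → Pt n → Bool
  upperCrossing x p = ⌊ belowRoot? p ⌋ ∧ ((rootRow p == row x) ∧ towardsUpper (row p) x)

  ∑-upperCrossing : ∀ x → ∑ₚ (ind ∘ upperCrossing x) ≤ crossings x
  ∑-upperCrossing x = begin
    sum (λ r → sum (λ a → ind (upperCrossing x (r , a))))
      ≡⟨ sum-cong-≗ (λ r → count≡sum (λ a → upperCrossing x (r , a))) ⟨
    sum (λ r → count (λ a → upperCrossing x (r , a)))
      ≤⟨ sum-mono-≤ (λ r → count-≤-ind _ (crossing x r) (at-most-one r) (crossing-row r)) ⟩
    sum (ind ∘ crossing x)
      ≡⟨ count≡sum (crossing x) ⟨
    crossings x ∎
    where
    open ≤-Reasoning
    below : ∀ r a → upperCrossing x (r , a) ≡ true → BelowRoot (r , a)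
    below r a crosses = isYes⇒ (belowRoot? (r , a)) (∧-trueˡ crosses)
    lands-in-row-x : ∀ r a → upperCrossing x (r , a) ≡ true → rootRow (r , a) ≡ row x
    lands-in-row-x r a crosses = ==⇒≡ (∧-trueˡ (∧-trueʳ {⌊ belowRoot? (r , a) ⌋} crosses))
    at-most-one : ∀ r → AtMostOne (λ a → upperCrossing x (r , a))
    at-most-one r a b a-crosses b-crosses = rootRow-injective (below r a a-crosses)
      (trans (lands-in-row-x r a a-crosses) (sym (lands-in-row-x r b b-crosses)))
    crossing-row : ∀ r a → upperCrossing x (r , a) ≡ true → crossing x r ≡ true
    crossing-row r a crosses = cong₂ _∧_
      (⇒isYes (toℕ r <? toℕ (row x))
        (subst (λ K → toℕ r < toℕ K) (lands-in-row-x r a crosses) (below r a crosses)))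
      (∧-trueʳ (∧-trueʳ {⌊ belowRoot? (r , a) ⌋} crosses))

  ∑-lowerShare : ∀ x → ∑ₚ (λ p → lowerShare x p (height p)) ≡ height x
  ∑-lowerShare x = ∑ₚ-if==ᵖ x height

  idInDegree : Pt n → ℕ
  idInDegree x = count (pointsTo x ∘ lookup (idEdges tree))

  idInDegree-≤ : ∀ x → idInDegree x ≤ crossings x + height x
  idInDegree-≤ x = begin
    count (pointsTo x ∘ lookup (idEdges tree))
      ≡⟨ count-lookup (pointsTo x) (idEdges tree) ⟩
    ∑ₗ (ind ∘ pointsTo x) (idEdges tree)
      ≡⟨ ∑ₗ-concatMap (ind ∘ pointsTo x) (concatMap idEdgesOf ∘ tree) (allFin m) ⟩
    ∑ₗ (∑ₗ (ind ∘ pointsTo x) ∘ concatMap idEdgesOf ∘ tree) (allFin m)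
      ≡⟨ ∑ₗ-allFin (∑ₗ (ind ∘ pointsTo x) ∘ concatMap idEdgesOf ∘ tree) ⟩
    sum (λ v → ∑ₗ (ind ∘ pointsTo x) (concatMap idEdgesOf (tree v)))
      ≡⟨ sum-cong-≗ (λ v → ∑ₗ-concatMap (ind ∘ pointsTo x) idEdgesOf (tree v)) ⟩
    sum (λ v → ∑ₗ edgeWeight (tree v))
      ≤⟨ ∑-trees edgeWeight ⟩
    ∑ₚ (rootedWeight edgeWeight)
      ≤⟨ sum-mono-≤ (λ r → sum-mono-≤ λ a → rootedWeight-≤ (r , a) (belowRoot? (r , a))) ⟩
    ∑ₚ (λ p → ind (upperCrossing x p) + lowerShare x p (height p))
      ≡⟨ trans (sum-cong-≗ λ r → ∑-distrib-+ (λ a → upper (r , a)) (λ a → lower (r , a)))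
               (∑-distrib-+ (λ r → sum λ a → upper (r , a)) (λ r → sum λ a → lower (r , a))) ⟩
    ∑ₚ (ind ∘ upperCrossing x) + ∑ₚ (λ p → lowerShare x p (height p))
      ≤⟨ +-mono-≤ (∑-upperCrossing x) (≤-reflexive (∑-lowerShare x)) ⟩
    crossings x + height x ∎
    where
    open ≤-Reasoning
    edgeWeight : Pt n × Pt n → ℕ
    edgeWeight e = ∑ₗ (ind ∘ pointsTo x) (idEdgesOf e)
    upper lower : Pt n → ℕ
    upper = ind ∘ upperCrossing x
    lower p = lowerShare x p (height p)
    rootedWeight-≤ : ∀ p (below? : Dec (BelowRoot p)) →
      (if ⌊ below? ⌋ then edgeWeight (p , root p) else 0) ≤
      ind (⌊ below? ⌋ ∧ ((rootRow p == row x) ∧ towardsUpper (row p) x)) + lowerShare x p (height p)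
    rootedWeight-≤ p (no _) = z≤n
    rootedWeight-≤ p (yes _) = idEdgesOf-pointsTo x p (rootRow p) (proj₂ (root p))

  inDegree-≤ : ∀ x → inDegree tree orientation clique x ≤ n ∸ 1
  inDegree-≤ x@(i , j) with toℕ i <? toℕ (rootRow x)
  ... | yes i<K = begin
    cliqueInDegree x + idInDegree x
      ≤⟨ +-mono-≤ (cliqueInDegree-belowRoot i<K) (idInDegree-≤ x) ⟩
    (n ∸ suc K) + (crossings x + (K ∸ toℕ i))
      ≤⟨ +-monoʳ-≤ (n ∸ suc K) (+-monoˡ-≤ (K ∸ toℕ i) (crossings-≤-row x)) ⟩
    (n ∸ suc K) + (toℕ i + (K ∸ toℕ i))
      ≡⟨ cong ((n ∸ suc K) +_) (m+[n∸m]≡n (<⇒≤ i<K)) ⟩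
    (n ∸ suc K) + K
      ≡⟨ cong (_∸ 1) (trans (sym (+-suc (n ∸ suc K) K)) (m∸n+n≡m (toℕ<n (rootRow x)))) ⟩
    n ∸ 1 ∎
    where
    open ≤-Reasoning
    K = toℕ (rootRow x)
  ... | no i≮K = begin
    cliqueInDegree x + idInDegree x
      ≤⟨ +-monoʳ-≤ (cliqueInDegree x) (idInDegree-≤ x) ⟩
    ρ + (crossings x + height x)
      ≡⟨ cong (λ h → ρ + (crossings x + h)) (m≤n⇒m∸n≡0 (≮⇒≥ i≮K)) ⟩
    ρ + (crossings x + 0)
      ≤⟨ +-monoʳ-≤ ρ (≤-trans (≤-reflexive (+-identityʳ (crossings x))) (crossings-≤-free x)) ⟩
    ρ + ((n ∸ ρ) ∸ 1)
      ≡⟨ sym (+-∸-assoc ρ (m<n⇒0<n∸m ρ<n)) ⟩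
    (ρ + (n ∸ ρ)) ∸ 1
      ≡⟨ cong (_∸ 1) (m+[n∸m]≡n (<⇒≤ ρ<n)) ⟩
    n ∸ 1 ∎
    where
    open ≤-Reasoning
    ρ = cliqueInDegree x
    ρ<n : ρ < n
    ρ<n = losses-< (clique-isTransitiveTournament i) j

mainTheorem3 : (n : ℕ) → 1 ≤ n → (m : ℕ) → (lab : Fin n → Fin n → Fin m) →
    Uniform lab → Linear lab →
    Σ (Fin m → List (Pt n × Pt n)) λ T →
      (∀ v → IsIdentifierSpanningTree lab v (T v)) ×
      Σ (IdOrientation T) λ o → VandermondeCompletable T o
mainTheorem3 n _ m lab uniform linear =
  tree , tree-isSpanningTree , orientation , clique , clique-isTransitiveTournament , inDegree-≤
  where open Construction lab uniform linear
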